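{- Let $n$ be a positive integer and let $p_1=(x_1,y_1),\ldots,p_{2n}=(x_{2n},y_{2n})$ be $2n$ distinct points of $[n]^2=\{1,\ldots,n\}^2$. Then there are four points $p_i,p_j,p_k,p_\ell$ among them such that $y_i=y_j<y_k=y_\ell$, $x_i<x_j$, $x_k<x_\ell$, and the intersection of real intervals $[x_i,x_j]\cap[x_k,x_\ell]$ contains at least two integers. -}

module Defs where

open import Data.Nat using (ℕ; _≤_)
open import Data.Product using (_×_; _,_)

-- integer m lies in the real interval [a, b] (a, b integers)
_∈[_,_] : ℕ → ℕ → ℕ → Set
m ∈[ a , b ] = a ≤ m × m ≤ b

InGrid : ℕ → ℕ × ℕ → Set
InGrid n (x , y) = (1 ≤ x × x ≤ n) × (1 ≤ y × y ≤ n)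

-- A point either has a point to its right in the same row, and is then labelled by its
-- column (which is < n), or is the rightmost point of its row, and is then labelled by
-- its row.  That gives (n - 1) + n labels for 2n points, so two distinct points share a
-- label.  Two rightmost points of one row coincide, so both points have right neighbours
-- and lie in the same column x of different rows; their segments both contain x and x + 1.
module Submission where

open import Defs
open import Data.Nat using (ℕ; suc; pred; _*_; _+_; _<_; _≤_; s≤s⁻¹)
open import Data.Nat.Properties using (≤-refl; ≤-trans; <⇒≤; n≤1+n; n<1+n; m≤m+n; +-mono-<-≤; <-cmp; _≟_; _<?_)
open import Data.Fin using (Fin; fromℕ<; join; splitAt)
open import Data.Fin.Properties using (pigeonhole; any?; fromℕ<-injective; splitAt-join; <⇒≢)
open import Data.Sum using (_⊎_; inj₁; inj₂)
open import Data.Sum.Properties using (inj₁-injective; inj₂-injective)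
open import Data.Product using (_×_; _,_; ∃-syntax; proj₁; proj₂)
open import Function.Definitions using (Injective)
open import Relation.Binary using (tri<; tri≈; tri>)
open import Relation.Binary.PropositionalEquality using (_≡_; _≢_; refl; sym; cong; cong₂; module ≡-Reasoning)
open import Relation.Nullary using (Dec; yes; no; ¬_)
open import Relation.Nullary.Decidable using (_×-dec_)
open import Data.Empty using (⊥-elim)

TwoCommonIntegers : ℕ → ℕ → ℕ → ℕ → Set
TwoCommonIntegers a b c d =
  ∃[ s ] ∃[ t ] (s < t × s ∈[ a , b ] × s ∈[ c , d ] × t ∈[ a , b ] × t ∈[ c , d ])

same-left-end⇒TwoCommonIntegers : ∀ {a b c d} → a ≡ c → a < b → c < d → TwoCommonIntegers a b c d
same-left-end⇒TwoCommonIntegers {a} refl a<b a<d =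
  a , suc a , ≤-refl , (≤-refl , <⇒≤ a<b) , (≤-refl , <⇒≤ a<d) , (n≤1+n a , a<b) , (n≤1+n a , a<d)

pred<n : ∀ {a n} → 1 ≤ a → a ≤ n → pred a < n
pred<n {suc _} _ a≤n = a≤n

pred-injective : ∀ {a b} → 1 ≤ a → 1 ≤ b → pred a ≡ pred b → a ≡ b
pred-injective {suc _} {suc _} _ _ = cong suc

join-injective : ∀ m n {u v : Fin m ⊎ Fin n} → join m n u ≡ join m n v → u ≡ v
join-injective m n {u} {v} e = begin
  u                           ≡⟨ splitAt-join m n u ⟨
  splitAt m (join m n u)      ≡⟨ cong (splitAt m) e ⟩
  splitAt m (join m n v)      ≡⟨ splitAt-join m n v ⟩
  v                           ∎
  where open ≡-Reasoning

module Points {N m : ℕ} (p : Fin N → ℕ × ℕ) (p-injective : Injective _≡_ _≡_ p)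
              (p∈grid : ∀ t → InGrid (suc m) (p t)) where

  x y : Fin N → ℕ
  x t = proj₁ (p t)
  y t = proj₂ (p t)

  StackedOverlappingSegments : Set
  StackedOverlappingSegments =
    ∃[ i ] ∃[ j ] ∃[ k ] ∃[ l ] (y i ≡ y j × y j < y k × y k ≡ y l × x i < x j × x k < x l
                                  × TwoCommonIntegers (x i) (x j) (x k) (x l))

  HasRightNeighbour : Fin N → Set
  HasRightNeighbour u = ∃[ v ] (y v ≡ y u × x u < x v)

  hasRightNeighbour? : ∀ u → Dec (HasRightNeighbour u)
  hasRightNeighbour? u = any? (λ v → (y v ≟ y u) ×-dec (x u <? x v))

  rightmost-unique : ∀ {u v} → ¬ HasRightNeighbour u → ¬ HasRightNeighbour v → y u ≡ y v → u ≡ v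
  rightmost-unique {u} {v} ¬ru ¬rv yu≡yv with <-cmp (x u) (x v)
  ... | tri< xu<xv _ _ = ⊥-elim (¬ru (v , sym yu≡yv , xu<xv))
  ... | tri≈ _ xu≡xv _ = p-injective (cong₂ _,_ xu≡xv yu≡yv)
  ... | tri> _ _ xv<xu = ⊥-elim (¬rv (u , yu≡yv , xv<xu))

  stacked : ∀ {u v} → HasRightNeighbour u → HasRightNeighbour v → x u ≡ x v → y u < y v →
            StackedOverlappingSegments
  stacked {u} {v} (u′ , yu′≡yu , xu<xu′) (v′ , yv′≡yv , xv<xv′) xu≡xv yu<yv =
    u , u′ , v , v′ , sym yu′≡yu , yu′<yv , sym yv′≡yv , xu<xu′ , xv<xv′ ,
    same-left-end⇒TwoCommonIntegers xu≡xv xu<xu′ xv<xv′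
    where
    yu′<yv : y u′ < y v
    yu′<yv rewrite yu′≡yu = yu<yv

  same-column : ∀ {u v} → u ≢ v → HasRightNeighbour u → HasRightNeighbour v → x u ≡ x v →
                StackedOverlappingSegments
  same-column {u} {v} u≢v ru rv xu≡xv with <-cmp (y u) (y v)
  ... | tri< yu<yv _ _ = stacked ru rv xu≡xv yu<yv
  ... | tri≈ _ yu≡yv _ = ⊥-elim (u≢v (p-injective (cong₂ _,_ xu≡xv yu≡yv)))
  ... | tri> _ _ yv<yu = stacked rv ru (sym xu≡xv) yv<yu

  1≤x : ∀ t → 1 ≤ x t
  1≤x t = proj₁ (proj₁ (p∈grid t))

  1≤y : ∀ t → 1 ≤ y t
  1≤y t = proj₁ (proj₂ (p∈grid t))

  column : ∀ {u} → HasRightNeighbour u → Fin m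
  column {u} (v , _ , xu<xv) =
    fromℕ< (pred<n (1≤x u) (s≤s⁻¹ (≤-trans xu<xv (proj₂ (proj₁ (p∈grid v))))))

  row : Fin N → Fin (suc m)
  row u = fromℕ< (pred<n (1≤y u) (proj₂ (proj₂ (p∈grid u))))

  label′ : ∀ u → Dec (HasRightNeighbour u) → Fin m ⊎ Fin (suc m)
  label′ u (yes ru) = inj₁ (column ru)
  label′ u (no _)   = inj₂ (row u)

  label : Fin N → Fin m ⊎ Fin (suc m)
  label u = label′ u (hasRightNeighbour? u)

  label-collision : ∀ {u v} → u ≢ v →
                    (du : Dec (HasRightNeighbour u)) (dv : Dec (HasRightNeighbour v)) →
                    label′ u du ≡ label′ v dv → StackedOverlappingSegments
  label-collision {u} {v} u≢v (yes ru) (yes rv) e =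
    same-column u≢v ru rv
      (pred-injective (1≤x u) (1≤x v) (fromℕ<-injective _ _ _ _ (inj₁-injective e)))
  label-collision {u} {v} u≢v (no ¬ru) (no ¬rv) e =
    ⊥-elim (u≢v (rightmost-unique ¬ru ¬rv
      (pred-injective (1≤y u) (1≤y v) (fromℕ<-injective _ _ _ _ (inj₂-injective e)))))
  label-collision _ (yes _) (no _) ()
  label-collision _ (no _) (yes _) ()

  more-points-than-labels : m + suc m < N → StackedOverlappingSegments
  more-points-than-labels labels<N with pigeonhole labels<N (λ u → join m (suc m) (label u))
  ... | i , j , i<j , same =
    label-collision (<⇒≢ i<j) (hasRightNeighbour? i) (hasRightNeighbour? j)
      (join-injective m (suc m) same)

lemma3p1 : (n : ℕ) → 1 ≤ n → (p : Fin (2 * n) → ℕ × ℕ) → Injective _≡_ _≡_ p → (∀ t → InGrid n (p t)) → ∃[ i ] ∃[ j ] ∃[ k ] ∃[ l ] ((proj₂ (p i) ≡ proj₂ (p j)) × (proj₂ (p j) < proj₂ (p k)) × (proj₂ (p k) ≡ proj₂ (p l)) × (proj₁ (p i) < proj₁ (p j)) × (proj₁ (p k) < proj₁ (p l)) × (∃[ a ] ∃[ b ] (a < b × a ∈[ proj₁ (p i) , proj₁ (p j) ] × a ∈[ proj₁ (p k) , proj₁ (p l) ] × b ∈[ proj₁ (p i) , proj₁ (p j) ] × b ∈[ proj₁ (p k) , proj₁ (p l) ])))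
lemma3p1 (suc m) _ p p-injective p∈grid =
  Points.more-points-than-labels p p-injective p∈grid (+-mono-<-≤ (n<1+n m) (m≤m+n (suc m) 0))
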